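{- Let $G$ be a connected graph with vertex set $V$ and let $\pi$ be a permutation of $V$ with $rt(G,\pi) > 1$. Then $rt(G,\pi) = 2$ if and only if the graph $G_{cycle(\pi)}$ has a perfect matching (where a loop at a vertex may be used to cover that vertex).
   Context: Routing via matchings: each vertex $v$ of $G$ initially holds a pebble, which must end at vertex $\pi(v)$. A step consists of choosing a matching of $G$ and swapping the pebbles at the two endpoints of every matched edge. The routing time $rt(G,\pi)$ is the minimum number of steps after which every pebble is at its destination. A cycle $C$ of $\pi$ (viewed as a subset of $V$) is individually routable if the pebbles on $C$ can be routed to their destinations in at most 2 steps using only edges of the induced subgraph $G[C]$. Two distinct cycles $C_1, C_2$ of $\pi$ are mutually routable in 2 steps if all pebbles on $C_1 \cup C_2$ can be routed to their destinations in at most 2 steps using only edges of $G$ with one endpoint in $C_1$ and the other in $C_2$. The graph $G_{cycle(\pi)}$ has the cycles of $\pi$ as vertices, two distinct cycles adjacent iff they are mutually routable in 2 steps, and a loop at each cycle that is individually routable. A perfect matching here is a set of edges and loops such that every vertex of $G_{cycle(\pi)}$ is covered exactly once. -}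

module Defs where

open import Data.Nat using (ℕ; zero; suc; _≤_; _<_)
open import Data.Fin using (Fin)
open import Data.Fin.Subset using (Subset; _∈_)
open import Data.Fin.Permutation using (Permutation′; _⟨$⟩ʳ_)
open import Data.Vec using (Vec; []; _∷_)
open import Data.Product using (Σ; ∃; _×_; _,_)
open import Data.Sum using (_⊎_)
open import Data.Unit using (⊤)
open import Relation.Nullary using (¬_)
open import Relation.Binary.PropositionalEquality using (_≡_; _≢_)
open import Relation.Binary.Construct.Closure.ReflexiveTransitive using (Star)
open import Function.Bundles using (_⇔_)

record Graph (n : ℕ) : Set₁ where
  field
    E      : Fin n → Fin n → Set
    sym    : ∀ {u v} → E u v → E v u
    irrefl : ∀ {v} → ¬ E v v

open Graph public

Connected : ∀ {n} → Graph n → Set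
Connected {n} G = ∀ (u v : Fin n) → Star (E G) u v

-- A matching using only edges satisfying R, represented by the involution
-- m swapping the two endpoints of each matched edge and fixing unmatched vertices.
record MatchingOn {n : ℕ} (R : Fin n → Fin n → Set) : Set where
  field
    m      : Fin n → Fin n
    invol  : ∀ v → m (m v) ≡ v
    edge   : ∀ v → m v ≢ v → R v (m v)

open MatchingOn public

-- Position of the pebble that started at v after performing the steps in order.
run : ∀ {n k} {R : Fin n → Fin n → Set} → Vec (MatchingOn R) k → Fin n → Fin n
run []       v = v
run (M ∷ Ms) v = run Ms (m M v)

-- Since empty matchings are allowed,
-- routable in k steps is the same as routable in at most k steps.
RoutableWith : ∀ {n} → (R : Fin n → Fin n → Set) → Permutation′ n → (S : Fin n → Set) → ℕ → Set
RoutableWith R π S k = Σ (Vec (MatchingOn R) k) λ Ms → ∀ v → S v → run Ms v ≡ π ⟨$⟩ʳ v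

AllVertices : ∀ {n} → Fin n → Set
AllVertices _ = ⊤

Routable : ∀ {n} → Graph n → Permutation′ n → ℕ → Set
Routable G π k = RoutableWith (E G) π AllVertices k

RoutingTime : ∀ {n} → Graph n → Permutation′ n → ℕ → Set
RoutingTime G π k = Routable G π k × (∀ j → j < k → ¬ Routable G π j)

iter : ∀ {n} → Permutation′ n → ℕ → Fin n → Fin n
iter π zero    v = v
iter π (suc k) v = π ⟨$⟩ʳ (iter π k v)

IsCycle : ∀ {n} → Permutation′ n → Subset n → Set
IsCycle {n} π C = ∃ λ (v : Fin n) → ∀ u → (u ∈ C ⇔ ∃ λ k → iter π k v ≡ u)

InducedE : ∀ {n} → Graph n → Subset n → Fin n → Fin n → Set
InducedE G C u v = E G u v × u ∈ C × v ∈ C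

BetweenE : ∀ {n} → Graph n → Subset n → Subset n → Fin n → Fin n → Set
BetweenE G C₁ C₂ u v = E G u v × ((u ∈ C₁ × v ∈ C₂) ⊎ (u ∈ C₂ × v ∈ C₁))

IndividuallyRoutable : ∀ {n} → Graph n → Permutation′ n → Subset n → Set
IndividuallyRoutable G π C = RoutableWith (InducedE G C) π (_∈ C) 2

MutuallyRoutable : ∀ {n} → Graph n → Permutation′ n → Subset n → Subset n → Set
MutuallyRoutable G π C₁ C₂ =
  RoutableWith (BetweenE G C₁ C₂) π (λ v → v ∈ C₁ ⊎ v ∈ C₂) 2

-- A perfect matching of G_cycle(π) (loops allowed), given as an involution μ on the
-- set of cycles of π: μ C ≡ C means C is covered by its loop (so C must be
-- individually routable); otherwise C is matched with the distinct cycle μ C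
-- (so they must be mutually routable in 2 steps).
HasPerfectCycleMatching : ∀ {n} → Graph n → Permutation′ n → Set
HasPerfectCycleMatching {n} G π =
  Σ (Subset n → Subset n) λ μ → ∀ C → IsCycle π C →
      IsCycle π (μ C)
    × μ (μ C) ≡ C
    × (μ C ≡ C → IndividuallyRoutable G π C)
    × (μ C ≢ C → MutuallyRoutable G π C (μ C))

-- If the matchings m₁, m₂ route π in two steps then m₂ ∘ m₁ = π, so π ∘ m₁ ∘ π = m₁: the
-- involution m₁ conjugates π to π⁻¹ and hence maps every cycle C onto a cycle μ C, with μ
-- an involution on cycles. Both m₁ and m₂ exchange C and μ C, so restricting them to C ∪ μ C
-- routes these pebbles inside G[C] if μ C = C and between C and μ C otherwise.
-- Conversely, for a perfect matching μ the sets C ∪ μ C partition V, and routings on the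
-- parts, each using only edges inside its part, glue to a routing of all of G.
module Submission where

open import Defs hiding (sym)
open import Data.Nat using (ℕ; zero; suc; _+_; _*_; _∸_; _≤_; s≤s)
open import Data.Nat.Properties using (+-comm; *-suc; m∸n+n≡m; +-∸-assoc; <⇒≤; n<1+n)
open import Data.Nat.DivMod using (_%_; _/_; m≡m%n+[m/n]*n; m%n<n)
open import Data.Bool using (Bool; true; if_then_else_)
import Data.Bool as Bool
open import Data.Fin using (Fin; toℕ; fromℕ<; _≟_)
open import Data.Fin.Properties using (pigeonhole; any?; toℕ-fromℕ<)
open import Data.Fin.Subset using (Subset; _∈_; _∪_; _⊆_)
open import Data.Fin.Subset.Properties using (_∈?_; ⊆-antisym; ∪-comm; p⊆p∪q; x∈p∪q⁺; x∈p∪q⁻)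
open import Data.Fin.Permutation using (Permutation′; _⟨$⟩ʳ_; _⟨$⟩ˡ_; inverseˡ)
open import Data.Vec using (Vec; []; _∷_; lookup; tabulate; head; tail; replicate)
import Data.Vec as Vec
open import Data.Vec.Properties using (≡-dec; lookup∘tabulate; []=⇒lookup; lookup⇒[]=)
open import Data.Product using (∃; _×_; _,_; proj₁; proj₂)
open import Data.Sum using (_⊎_; inj₁; inj₂; [_,_]′)
open import Data.Unit using (tt)
open import Relation.Nullary using (¬_; Dec; yes; no; does; contradiction)
open import Relation.Nullary.Decidable using (_⊎-dec_; dec-true; dec-false)
open import Relation.Binary.Core using (_⇒_)
open import Relation.Binary.PropositionalEquality
  using (_≡_; _≢_; refl; sym; trans; cong; subst; module ≡-Reasoning)
open import Function.Bundles using (_⇔_; mk⇔; Equivalence)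

open Equivalence using (to; from)

module _ {n : ℕ} (π : Permutation′ n) where

  iter-+ : ∀ a b v → iter π (a + b) v ≡ iter π a (iter π b v)
  iter-+ zero    b v = refl
  iter-+ (suc a) b v = cong (π ⟨$⟩ʳ_) (iter-+ a b v)

  iter-injective : ∀ k {x y} → iter π k x ≡ iter π k y → x ≡ y
  iter-injective zero    eq = eq
  iter-injective (suc k) eq =
    iter-injective k (trans (sym (inverseˡ π)) (trans (cong (π ⟨$⟩ˡ_) eq) (inverseˡ π)))

  iter-comm : ∀ a b v → iter π a (iter π b v) ≡ iter π b (iter π a v)
  iter-comm a b v =
    trans (sym (iter-+ a b v)) (trans (cong (λ k → iter π k v) (+-comm a b)) (iter-+ b a v))

  -- Two of the n + 1 points v, π v, …, πⁿ v coincide, and π is injective.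
  iter-period : ∀ v → ∃ λ p → iter π (suc p) v ≡ v
  iter-period v with pigeonhole (n<1+n n) (λ (i : Fin (suc n)) → iter π (toℕ i) v)
  ... | i , j , i<j , eq = toℕ j ∸ suc (toℕ i) , iter-injective (toℕ i) (begin
      iter π (toℕ i) (iter π (suc (toℕ j ∸ suc (toℕ i))) v)
        ≡⟨ cong (λ d → iter π (toℕ i) (iter π d v)) (sym (+-∸-assoc 1 i<j)) ⟩
      iter π (toℕ i) (iter π (toℕ j ∸ toℕ i) v)
        ≡⟨ iter-comm (toℕ i) (toℕ j ∸ toℕ i) v ⟩
      iter π (toℕ j ∸ toℕ i) (iter π (toℕ i) v)
        ≡⟨ sym (iter-+ (toℕ j ∸ toℕ i) (toℕ i) v) ⟩
      iter π (toℕ j ∸ toℕ i + toℕ i) v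
        ≡⟨ cong (λ k → iter π k v) (m∸n+n≡m (<⇒≤ i<j)) ⟩
      iter π (toℕ j) v
        ≡⟨ sym eq ⟩
      iter π (toℕ i) v ∎)
    where open ≡-Reasoning

  iter-*-period : ∀ {p v} → iter π (suc p) v ≡ v → ∀ a → iter π (a * suc p) v ≡ v
  iter-*-period e zero    = refl
  iter-*-period {p} {v} e (suc a) =
    trans (iter-+ (suc p) (a * suc p) v) (trans (cong (iter π (suc p)) (iter-*-period e a)) e)

  iter-%-period : ∀ {p v} → iter π (suc p) v ≡ v → ∀ k → iter π k v ≡ iter π (k % suc p) v
  iter-%-period {p} {v} e k =
    trans (cong (λ j → iter π j v) (m≡m%n+[m/n]*n k (suc p)))
          (trans (iter-+ (k % suc p) (k / suc p * suc p) v)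
                 (cong (iter π (k % suc p)) (iter-*-period e (k / suc p))))

  SameCycle : Fin n → Fin n → Set
  SameCycle x y = ∃ λ k → iter π k x ≡ y

  sameCycle-refl : ∀ {x} → SameCycle x x
  sameCycle-refl = 0 , refl

  sameCycle-trans : ∀ {x y z} → SameCycle x y → SameCycle y z → SameCycle x z
  sameCycle-trans {x} (k , refl) (l , refl) = l + k , iter-+ l k x

  sameCycle-step : ∀ {x y} → SameCycle x y → SameCycle x (π ⟨$⟩ʳ y)
  sameCycle-step (k , refl) = suc k , refl

  sameCycle-sym : ∀ {x y} → SameCycle x y → SameCycle y x
  sameCycle-sym {x} (k , refl) with iter-period x
  ... | p , e = k * p , (begin
      iter π (k * p) (iter π k x) ≡⟨ sym (iter-+ (k * p) k x) ⟩
      iter π (k * p + k) x        ≡⟨ cong (λ j → iter π j x) (trans (+-comm (k * p) k) (sym (*-suc k p))) ⟩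
      iter π (k * suc p) x        ≡⟨ iter-*-period e k ⟩
      x                           ∎)
    where open ≡-Reasoning

  sameCycle? : ∀ x y → Dec (SameCycle x y)
  sameCycle? x y with iter-period x
  ... | p , e with any? (λ (i : Fin (suc p)) → iter π (toℕ i) x ≟ y)
  ... | yes (i , eq) = yes (toℕ i , eq)
  ... | no ¬short = no λ (k , eq) → ¬short (fromℕ< (m%n<n k (suc p)) ,
          trans (cong (λ j → iter π j x) (toℕ-fromℕ< (m%n<n k (suc p))))
                (trans (sym (iter-%-period e k)) eq))

∈-tabulate⁺ : ∀ {n} {f : Fin n → Bool} {u} → f u ≡ true → u ∈ tabulate f
∈-tabulate⁺ {f = f} {u} fu = lookup⇒[]= u (tabulate f) (trans (lookup∘tabulate f u) fu)

∈-tabulate⁻ : ∀ {n} {f : Fin n → Bool} {u} → u ∈ tabulate f → f u ≡ true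
∈-tabulate⁻ {f = f} {u} u∈ = trans (sym (lookup∘tabulate f u)) ([]=⇒lookup u∈)

preimage : ∀ {n} → (Fin n → Fin n) → Subset n → Subset n
preimage f C = tabulate (λ u → lookup C (f u))

∈-preimage⁺ : ∀ {n} {f : Fin n → Fin n} {C u} → f u ∈ C → u ∈ preimage f C
∈-preimage⁺ fu∈C = ∈-tabulate⁺ ([]=⇒lookup fu∈C)

∈-preimage⁻ : ∀ {n} {f : Fin n → Fin n} {C u} → u ∈ preimage f C → f u ∈ C
∈-preimage⁻ {C = C} {u} u∈ = lookup⇒[]= _ C (∈-tabulate⁻ u∈)

preimage-involutive : ∀ {n} {f : Fin n → Fin n} → (∀ v → f (f v) ≡ v) →
                      ∀ C → preimage f (preimage f C) ≡ C
preimage-involutive {f = f} invol C = ⊆-antisym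
  (λ {v} v∈ → subst (_∈ C) (invol v) (∈-preimage⁻ (∈-preimage⁻ v∈)))
  (λ {v} v∈ → ∈-preimage⁺ (∈-preimage⁺ (subst (_∈ C) (sym (invol v)) v∈)))

module _ {n : ℕ} (π : Permutation′ n) where

  cycleOf : Fin n → Subset n
  cycleOf v = tabulate (λ u → does (sameCycle? π v u))

  ∈-cycleOf⁺ : ∀ {v u} → SameCycle π v u → u ∈ cycleOf v
  ∈-cycleOf⁺ {v} {u} r = ∈-tabulate⁺ (dec-true (sameCycle? π v u) r)

  ∈-cycleOf⁻ : ∀ {v u} → u ∈ cycleOf v → SameCycle π v u
  ∈-cycleOf⁻ {v} {u} u∈ with sameCycle? π v u | ∈-tabulate⁻ {f = λ u → does (sameCycle? π v u)} u∈
  ... | yes r | _  = r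
  ... | no _  | ()

  cycleOf-isCycle : ∀ v → IsCycle π (cycleOf v)
  cycleOf-isCycle v = v , λ u → mk⇔ ∈-cycleOf⁻ ∈-cycleOf⁺

  ∈-cycleOf-self : ∀ v → v ∈ cycleOf v
  ∈-cycleOf-self v = ∈-cycleOf⁺ (sameCycle-refl π)

  isCycle-≡-cycleOf : ∀ {C u} → IsCycle π C → u ∈ C → C ≡ cycleOf u
  isCycle-≡-cycleOf {C} {u} (c , ∈C⇔) u∈C = ⊆-antisym
    (λ x∈C → ∈-cycleOf⁺ (sameCycle-trans π (sameCycle-sym π (to (∈C⇔ u) u∈C)) (to (∈C⇔ _) x∈C)))
    (λ x∈ → from (∈C⇔ _) (sameCycle-trans π (to (∈C⇔ u) u∈C) (∈-cycleOf⁻ x∈)))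

  isCycle-closed : ∀ {C u} → IsCycle π C → u ∈ C → π ⟨$⟩ʳ u ∈ C
  isCycle-closed (c , ∈C⇔) u∈C = from (∈C⇔ _) (sameCycle-step π (to (∈C⇔ _) u∈C))

module _ {n : ℕ} where

  private variable
    R R′ : Fin n → Fin n → Set
    k    : ℕ

  Within : (Fin n → Fin n → Set) → Subset n → Fin n → Fin n → Set
  Within R B u w = R u w × u ∈ B × w ∈ B

  Between : (Fin n → Fin n → Set) → Subset n → Subset n → Fin n → Fin n → Set
  Between R C D u w = R u w × ((u ∈ C × w ∈ D) ⊎ (u ∈ D × w ∈ C))

  Swaps : (Fin n → Fin n) → Subset n → Subset n → Set
  Swaps f C D = (∀ {v} → v ∈ C → f v ∈ D) × (∀ {v} → v ∈ D → f v ∈ C)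

  swaps-closed : ∀ {f C D v} → Swaps f C D → v ∈ C ⊎ v ∈ D → f v ∈ C ⊎ f v ∈ D
  swaps-closed swaps (inj₁ v∈C) = inj₂ (proj₁ swaps v∈C)
  swaps-closed swaps (inj₂ v∈D) = inj₁ (proj₂ swaps v∈D)

  within-⊆ : ∀ {B B′} → B ⊆ B′ → Within R B ⇒ Within R B′
  within-⊆ B⊆B′ (e , u∈ , w∈) = e , B⊆B′ u∈ , B⊆B′ w∈

  between⇒within-∪ : ∀ {C D} → Between R C D ⇒ Within R (C ∪ D)
  between⇒within-∪ (e , inj₁ (u∈C , w∈D)) = e , x∈p∪q⁺ (inj₁ u∈C) , x∈p∪q⁺ (inj₂ w∈D)
  between⇒within-∪ (e , inj₂ (u∈D , w∈C)) = e , x∈p∪q⁺ (inj₂ u∈D) , x∈p∪q⁺ (inj₁ w∈C)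

  idMatching : MatchingOn R
  idMatching = record { m = λ v → v ; invol = λ _ → refl ; edge = λ _ v≢v → contradiction refl v≢v }

  mapMatching : R ⇒ R′ → MatchingOn R → MatchingOn R′
  mapMatching f M = record { m = m M ; invol = invol M ; edge = λ v m≢v → f (edge M v m≢v) }

  run-mapMatching : (f : R ⇒ R′) (Ms : Vec (MatchingOn R) k) (v : Fin n) →
                    run (Vec.map (mapMatching f) Ms) v ≡ run Ms v
  run-mapMatching f []       v = refl
  run-mapMatching f (M ∷ Ms) v = run-mapMatching f Ms (m M v)

  run-∷ : (Ms : Vec (MatchingOn R) (suc k)) (v : Fin n) → run Ms v ≡ run (tail Ms) (m (head Ms) v)
  run-∷ (M ∷ Ms) v = refl

  routableWith-mono : ∀ {π} {S S′ : Fin n → Set} → R ⇒ R′ → (∀ {v} → S′ v → S v) →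
                      RoutableWith R π S k → RoutableWith R′ π S′ k
  routableWith-mono f S′⊆S (Ms , routes) =
    Vec.map (mapMatching f) Ms , λ v v∈S′ → trans (run-mapMatching f Ms v) (routes v (S′⊆S v∈S′))

  within-closed : ∀ {B} (M : MatchingOn (Within R B)) {v} → v ∈ B → m M v ∈ B
  within-closed M {v} v∈B with m M v ≟ v
  ... | yes mv≡v = subst (_∈ _) (sym mv≡v) v∈B
  ... | no  mv≢v = proj₂ (proj₂ (edge M v mv≢v))

  module _ {C D : Subset n} (M : MatchingOn R) (swaps : Swaps (m M) C D) where

    private
      inC⊎D? : ∀ v → Dec (v ∈ C ⊎ v ∈ D)
      inC⊎D? v = (v ∈? C) ⊎-dec (v ∈? D)

      side : ∀ {v} → v ∈ C ⊎ v ∈ D → (v ∈ C × m M v ∈ D) ⊎ (v ∈ D × m M v ∈ C)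
      side (inj₁ v∈C) = inj₁ (v∈C , proj₁ swaps v∈C)
      side (inj₂ v∈D) = inj₂ (v∈D , proj₂ swaps v∈D)

      restricted : Fin n → Fin n
      restricted v = if does (inC⊎D? v) then m M v else v

    restrict-inside : ∀ {v} → v ∈ C ⊎ v ∈ D → restricted v ≡ m M v
    restrict-inside {v} v∈ rewrite dec-true (inC⊎D? v) v∈ = refl

    restrict-outside : ∀ {v} → ¬ (v ∈ C ⊎ v ∈ D) → restricted v ≡ v
    restrict-outside {v} v∉ rewrite dec-false (inC⊎D? v) v∉ = refl

    restrict : MatchingOn (Between R C D)
    restrict = record { m = restricted ; invol = restricted-invol ; edge = restricted-edge }
      where
      restricted-invol : ∀ v → restricted (restricted v) ≡ v
      restricted-invol v with inC⊎D? v
      ... | yes v∈ = trans (cong restricted (restrict-inside v∈))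
                           (trans (restrict-inside (swaps-closed swaps v∈)) (invol M v))
      ... | no  v∉ = trans (cong restricted (restrict-outside v∉)) (restrict-outside v∉)

      restricted-edge : ∀ v → restricted v ≢ v → Between R C D v (restricted v)
      restricted-edge v r≢v with inC⊎D? v
      ... | no  v∉ = contradiction (restrict-outside v∉) r≢v
      ... | yes v∈ = subst (Between R C D v) (sym (restrict-inside v∈))
                       (edge M v (λ mv≡v → r≢v (trans (restrict-inside v∈) mv≡v)) , side v∈)

  module _ (block : Fin n → Subset n) (∈-block : ∀ v → v ∈ block v)
           (block-≡ : ∀ {u} v → u ∈ block v → block u ≡ block v) where

    glue : ((B : Subset n) → MatchingOn (Within R B)) → MatchingOn R
    glue M = record
      { m     = glued
      ; invol = λ v → trans (cong (λ B → m (M B) (glued v)) (block-≡ v (stays v))) (invol (M (block v)) v)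
      ; edge  = λ v g≢v → proj₁ (edge (M (block v)) v g≢v)
      }
      where
      glued : Fin n → Fin n
      glued v = m (M (block v)) v

      stays : ∀ v → glued v ∈ block v
      stays v = within-closed (M (block v)) (∈-block v)

    glueAll : ((B : Subset n) → Vec (MatchingOn (Within R B)) k) → Vec (MatchingOn R) k
    glueAll {k = zero}  Ms = []
    glueAll {k = suc k} Ms = glue (λ B → head (Ms B)) ∷ glueAll (λ B → tail (Ms B))

    run-glueAll : (Ms : (B : Subset n) → Vec (MatchingOn (Within R B)) k) (v : Fin n) →
                  run (glueAll Ms) v ≡ run (Ms (block v)) v
    run-glueAll {k = zero}  Ms v with Ms (block v)
    ... | [] = refl
    run-glueAll {k = suc k} Ms v = begin
      run (glueAll (λ B → tail (Ms B))) w  ≡⟨ run-glueAll (λ B → tail (Ms B)) w ⟩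
      run (tail (Ms (block w))) w          ≡⟨ cong (λ B → run (tail (Ms B)) w) (block-≡ v w∈block) ⟩
      run (tail (Ms (block v))) w          ≡⟨ sym (run-∷ (Ms (block v)) v) ⟩
      run (Ms (block v)) v                 ∎
      where
      open ≡-Reasoning
      w = m (head (Ms (block v))) v
      w∈block : w ∈ block v
      w∈block = within-closed (head (Ms (block v))) (∈-block v)

    -- The routing used on a block may depend only on the block, not on the vertex that
    -- produced it, so it is taken from the first vertex found (by search) whose block it is.
    glue-routable : ∀ {π} → (∀ v → RoutableWith (Within R (block v)) π (_∈ block v) k) →
                    RoutableWith R π AllVertices k
    glue-routable {R = R} {k = k} {π} route =
      glueAll routing , λ v _ →
        trans (run-glueAll routing v) (routingFor-routes (isBlock? (block v)) (v , refl) v (∈-block v))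
      where
      isBlock? : ∀ B → Dec (∃ λ u → B ≡ block u)
      isBlock? B = any? (λ u → ≡-dec Bool._≟_ B (block u))

      routingFor : ∀ B → Dec (∃ λ u → B ≡ block u) → Vec (MatchingOn (Within R B)) k
      routingFor B (yes (u , refl)) = proj₁ (route u)
      routingFor B (no _)           = replicate k idMatching

      routing : (B : Subset n) → Vec (MatchingOn (Within R B)) k
      routing B = routingFor B (isBlock? B)

      routingFor-routes : ∀ {B} (b? : Dec (∃ λ u → B ≡ block u)) → ∃ (λ u → B ≡ block u) →
                          ∀ v → v ∈ B → run (routingFor B b?) v ≡ π ⟨$⟩ʳ v
      routingFor-routes (yes (u , refl)) _ = proj₂ (route u)
      routingFor-routes (no ¬b)          b = contradiction b ¬b

module TwoStepRouting {n : ℕ} (G : Graph n) (π : Permutation′ n) (M₁ M₂ : MatchingOn (E G))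
                      (routes : ∀ v → m M₂ (m M₁ v) ≡ π ⟨$⟩ʳ v) where

  private
    m₁ m₂ : Fin n → Fin n
    m₁ = m M₁
    m₂ = m M₂

  m₂≡π∘m₁ : ∀ w → m₂ w ≡ π ⟨$⟩ʳ m₁ w
  m₂≡π∘m₁ w = trans (cong m₂ (sym (invol M₁ w))) (routes (m₁ w))

  π∘m₁∘π≡m₁ : ∀ x → π ⟨$⟩ʳ m₁ (π ⟨$⟩ʳ x) ≡ m₁ x
  π∘m₁∘π≡m₁ x = begin
    π ⟨$⟩ʳ m₁ (π ⟨$⟩ʳ x)  ≡⟨ sym (m₂≡π∘m₁ (π ⟨$⟩ʳ x)) ⟩
    m₂ (π ⟨$⟩ʳ x)         ≡⟨ cong m₂ (sym (routes x)) ⟩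
    m₂ (m₂ (m₁ x))        ≡⟨ invol M₂ (m₁ x) ⟩
    m₁ x                  ∎
    where open ≡-Reasoning

  sameCycle-m₁ : ∀ {x y} → SameCycle π x y → SameCycle π (m₁ x) (m₁ y)
  sameCycle-m₁ {x} (k , refl) = sameCycle-sym π (backwards k)
    where
    backwards : ∀ k → SameCycle π (m₁ (iter π k x)) (m₁ x)
    backwards zero    = sameCycle-refl π
    backwards (suc k) = sameCycle-trans π (1 , π∘m₁∘π≡m₁ (iter π k x)) (backwards k)

  partner : Subset n → Subset n
  partner = preimage m₁

  partner-isCycle : ∀ {C} → IsCycle π C → IsCycle π (partner C)
  partner-isCycle (c , ∈C⇔) = m₁ c , λ u → mk⇔
    (λ u∈ → subst (SameCycle π (m₁ c)) (invol M₁ u) (sameCycle-m₁ (to (∈C⇔ _) (∈-preimage⁻ u∈))))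
    (λ r → ∈-preimage⁺ (from (∈C⇔ _) (subst (λ z → SameCycle π z (m₁ u)) (invol M₁ c) (sameCycle-m₁ r))))

  m₁-swaps : ∀ C → Swaps m₁ C (partner C)
  m₁-swaps C = (λ {v} v∈C → ∈-preimage⁺ (subst (_∈ C) (sym (invol M₁ v)) v∈C)) , ∈-preimage⁻

  m₂-swaps : ∀ {C} → IsCycle π C → Swaps m₂ C (partner C)
  m₂-swaps {C} isCycle =
    m₂-into (partner-isCycle isCycle) (proj₁ (m₁-swaps C)) , m₂-into isCycle (proj₂ (m₁-swaps C))
    where
    m₂-into : ∀ {X Y} → IsCycle π Y → (∀ {v} → v ∈ X → m₁ v ∈ Y) → ∀ {v} → v ∈ X → m₂ v ∈ Y
    m₂-into isCycleY m₁-into {v} v∈X =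
      subst (_∈ _) (sym (m₂≡π∘m₁ v)) (isCycle-closed π isCycleY (m₁-into v∈X))

  routableBetween : ∀ {C D} → Swaps m₁ C D → Swaps m₂ C D →
                    RoutableWith (Between (E G) C D) π (λ v → v ∈ C ⊎ v ∈ D) 2
  routableBetween {C} {D} swaps₁ swaps₂ = M₁∣ ∷ M₂∣ ∷ [] , λ v v∈ → begin
    m M₂∣ (m M₁∣ v)  ≡⟨ cong (m M₂∣) (restrict-inside M₁ swaps₁ v∈) ⟩
    m M₂∣ (m₁ v)     ≡⟨ restrict-inside M₂ swaps₂ (swaps-closed swaps₁ v∈) ⟩
    m₂ (m₁ v)        ≡⟨ routes v ⟩
    π ⟨$⟩ʳ v         ∎
    where
    open ≡-Reasoning
    M₁∣ M₂∣ : MatchingOn (Between (E G) C D)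
    M₁∣ = restrict M₁ swaps₁
    M₂∣ = restrict M₂ swaps₂

  mutuallyRoutable : ∀ {C} → IsCycle π C → MutuallyRoutable G π C (partner C)
  mutuallyRoutable {C} isCycle = routableBetween (m₁-swaps C) (m₂-swaps isCycle)

  individuallyRoutable : ∀ {C} → IsCycle π C → partner C ≡ C → IndividuallyRoutable G π C
  individuallyRoutable {C} isCycle self-partner = routableWith-mono {π = π} between-self⇒within inj₁
    (routableBetween (swaps (m₁-swaps C)) (swaps (m₂-swaps isCycle)))
    where
    swaps : ∀ {f} → Swaps f C (partner C) → Swaps f C C
    swaps = subst (Swaps _ C) self-partner

    between-self⇒within : Between (E G) C C ⇒ InducedE G C
    between-self⇒within (e , inj₁ (u∈ , w∈)) = e , u∈ , w∈
    between-self⇒within (e , inj₂ (u∈ , w∈)) = e , u∈ , w∈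

  perfectCycleMatching : HasPerfectCycleMatching G π
  perfectCycleMatching = partner , λ C isCycle →
    partner-isCycle isCycle , preimage-involutive (invol M₁) C ,
    individuallyRoutable isCycle , λ _ → mutuallyRoutable isCycle

module PerfectCycleMatchingRouting {n : ℕ} (G : Graph n) (π : Permutation′ n)
                                   (matching : HasPerfectCycleMatching G π) where

  private
    μ : Subset n → Subset n
    μ = proj₁ matching

    μ-isCycle : ∀ {C} → IsCycle π C → IsCycle π (μ C)
    μ-isCycle isCycle = proj₁ (proj₂ matching _ isCycle)

    μ-involutive : ∀ {C} → IsCycle π C → μ (μ C) ≡ C
    μ-involutive isCycle = proj₁ (proj₂ (proj₂ matching _ isCycle))

    individually : ∀ {C} → IsCycle π C → μ C ≡ C → IndividuallyRoutable G π C
    individually isCycle = proj₁ (proj₂ (proj₂ (proj₂ matching _ isCycle)))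

    mutually : ∀ {C} → IsCycle π C → μ C ≢ C → MutuallyRoutable G π C (μ C)
    mutually isCycle = proj₂ (proj₂ (proj₂ (proj₂ matching _ isCycle)))

  block : Fin n → Subset n
  block v = cycleOf π v ∪ μ (cycleOf π v)

  ∈-block : ∀ v → v ∈ block v
  ∈-block v = p⊆p∪q _ (∈-cycleOf-self π v)

  block-≡ : ∀ {u} v → u ∈ block v → block u ≡ block v
  block-≡ {u} v u∈ with x∈p∪q⁻ (cycleOf π v) (μ (cycleOf π v)) u∈
  ... | inj₁ u∈C = cong (λ X → X ∪ μ X) (sym (isCycle-≡-cycleOf π (cycleOf-isCycle π v) u∈C))
  ... | inj₂ u∈μC = begin
    cycleOf π u ∪ μ (cycleOf π u)  ≡⟨ cong (λ X → X ∪ μ X) (sym (isCycle-≡-cycleOf π (μ-isCycle C-isCycle) u∈μC)) ⟩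
    μ C ∪ μ (μ C)                  ≡⟨ cong (μ C ∪_) (μ-involutive C-isCycle) ⟩
    μ C ∪ C                        ≡⟨ ∪-comm (μ C) C ⟩
    C ∪ μ C                        ∎
    where
    open ≡-Reasoning
    C = cycleOf π v
    C-isCycle = cycleOf-isCycle π v

  routableOnPair : ∀ {C} → IsCycle π C → RoutableWith (Within (E G) (C ∪ μ C)) π (_∈ C ∪ μ C) 2
  routableOnPair {C} isCycle with ≡-dec Bool._≟_ (μ C) C
  ... | yes self-partner = routableWith-mono {π = π} (within-⊆ {R = E G} (p⊆p∪q _))
          (λ u∈ → [ (λ u∈C → u∈C) , subst (_ ∈_) self-partner ]′ (x∈p∪q⁻ C (μ C) u∈))
          (individually isCycle self-partner)
  ... | no ¬self-partner = routableWith-mono {π = π} (between⇒within-∪ {R = E G}) (x∈p∪q⁻ _ _)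
          (mutually isCycle ¬self-partner)

  routable : Routable G π 2
  routable = glue-routable block ∈-block block-≡ {R = E G} {π = π}
    (λ v → routableOnPair (cycleOf-isCycle π v))

lemma3 : ∀ {n : ℕ} (G : Graph n) (π : Permutation′ n) →
    Connected G →
    (∀ j → j ≤ 1 → ¬ Routable G π j) →
    (RoutingTime G π 2 ⇔ HasPerfectCycleMatching G π)
lemma3 G π _ not-faster = mk⇔ matchingOf routingTimeOf
  where
  matchingOf : RoutingTime G π 2 → HasPerfectCycleMatching G π
  matchingOf ((M₁ ∷ M₂ ∷ [] , routes) , _) =
    TwoStepRouting.perfectCycleMatching G π M₁ M₂ (λ v → routes v tt)

  routingTimeOf : HasPerfectCycleMatching G π → RoutingTime G π 2
  routingTimeOf matching =
    PerfectCycleMatchingRouting.routable G π matching , λ { j (s≤s j≤1) → not-faster j j≤1 }
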